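{- Let $2<m\le n+1$ and $\alpha=(a_1,\dots,a_m)\in[n]^m$ be such that $(a_2,\dots,a_{m-1})\in Sh_{m-1}(k-1,n-k)$ for some $k\in[n]$, and let $(a_{i_1},\dots,a_{i_{m-n+k-2}})$ be the subsequence of entries of $(a_2,\dots,a_{m-1})$ that are less than $k$. If $m\le n$, let $j\in[k-1]$ be such that $(a_{i_1},\dots,a_{i_{m-n+k-2}})\in Sh_{m-n+k-1}(j-1,k-j-1)$; if $m=n+1$, set $j=0$. Then $\alpha$ is an $(m-2)$-metered $(m,n)$-parking function if and only if either ($a_1\le j$ and $a_m\le k$) or ($j<a_1\le k$ and $a_m\le a_1$).
   Context: $[n]=\{1,\dots,n\}$. For integers $0\le r\le s$, $\mathrm{PF}_{r,s}$ is the set of sequences $(c_1,\dots,c_r)\in[s]^r$ whose nondecreasing rearrangement $c'_1\le\dots\le c'_r$ satisfies $c'_i\le s-r+i$ for all $i$; $\mathrm{PF}_{0,s}$ contains only the empty sequence, and $\mathrm{PF}_{r,s}=\emptyset$ if $r<0$ or $r>s$. For positive integers $M,N$ and $k\in[N]$, $Sh_M(k-1,N-k)$ is the set of all sequences of length $M-1$ that are shuffles (interleavings preserving the internal order of each word) of some word $\gamma\in\mathrm{PF}_{M-N+k-1,k-1}$ and the word $(b_1+k,\dots,b_{N-k}+k)$ for some $(b_1,\dots,b_{N-k})\in\mathrm{PF}_{N-k,N-k}$ (so $Sh_{m-1}(k-1,n-k)$ uses $M=m-1,N=n$, and $Sh_{m-n+k-1}(j-1,k-j-1)$ uses $M=m-n+k-1$,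 $N=k-1$ with $j$ in the role of $k$). For a nonnegative integer $t$, the $t$-metered parking scheme on $n$ spots: cars $1,\dots,m$ arrive in order; car $i$ parks in spot $a_i$ if unoccupied, else in the first unoccupied spot numbered greater than $a_i$, else fails to park; immediately after car $j$ parks, car $j-t$ (if $j-t\ge1$) leaves. $\alpha$ is a $t$-metered $(m,n)$-parking function if all cars park. -}

module Defs where

open import Data.Nat using (ℕ; zero; suc; _+_; _∸_; _≤_; _<_; _<?_)
open import Data.Nat.Properties using (≤-decTotalOrder)
open import Data.List using (List; []; _∷_; length; map; upTo; take; _++_; [_]; filter)
open import Data.List.Relation.Unary.All using (All)
open import Data.List.Membership.DecPropositional (Data.Nat._≟_) using (_∈?_)
open import Data.List.Relation.Ternary.Interleaving.Propositional using (Interleaving)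
open import Data.List.Sort ≤-decTotalOrder using (sort)
open import Data.Maybe using (Maybe; just; nothing)
open import Data.Product using (_×_; Σ; ∃)
open import Data.Unit using (⊤)
open import Relation.Nullary using (yes; no)
open import Relation.Binary.PropositionalEquality using (_≡_)

BoundedFrom : ℕ → List ℕ → Set
BoundedFrom b []       = ⊤
BoundedFrom b (x ∷ xs) = x ≤ b × BoundedFrom (suc b) xs

PF : ℕ → ℕ → List ℕ → Set
PF r s c =
  length c ≡ r × r ≤ s × All (λ x → 1 ≤ x × x ≤ s) c
  × BoundedFrom (suc (s ∸ r)) (sort c)

-- w ∈ Sh_M(k-1, N-k) : w is a shuffle of some γ ∈ PF_{M-N+k-1,k-1}
-- and (b_1+k,...,b_{N-k}+k) with b ∈ PF_{N-k,N-k}, and length w = M-1.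
-- The (integer) length condition length γ = M-N+k-1 is written
-- additively as length γ + (N-k) + 1 = M, so no truncated subtraction occurs.
Sh : ℕ → ℕ → ℕ → List ℕ → Set
Sh M N k w =
  Σ (List ℕ) λ γ → Σ (List ℕ) λ b →
    (length γ + (N ∸ k) + 1 ≡ M) × PF (length γ) (k ∸ 1) γ × PF (N ∸ k) (N ∸ k) b
    × Interleaving γ (map (λ x → x + k) b) w

firstFree : List ℕ → List ℕ → Maybe ℕ
firstFree occ []       = nothing
firstFree occ (s ∷ ss) with s ∈? occ
... | yes _ = firstFree occ ss
... | no  _ = just s

spotsFrom : ℕ → ℕ → List ℕ
spotsFrom n a = map (λ i → a + i) (upTo (suc n ∸ a))

-- t-metered parking on n spots.  `recent` = spots of the cars parked so
-- far, most recent first.  When a car arrives (car i), the cars still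
-- parked are cars i-t, ..., i-1, i.e. the t most recent ones.
meteredRun : ℕ → ℕ → List ℕ → List ℕ → Maybe (List ℕ)
meteredRun t n recent []       = just recent
meteredRun t n recent (a ∷ as) with firstFree (take t recent) (spotsFrom n a)
... | nothing = nothing
... | just s  = meteredRun t n (s ∷ recent) as

data IsJust {A : Set} : Maybe A → Set where
  isJust : ∀ x → IsJust (just x)

MeteredPF : ℕ → ℕ → List ℕ → Set
MeteredPF t n α = IsJust (meteredRun t n [] α)

-- With t = m − 2 nobody leaves before car m − 1 has parked, and then only car 1 leaves.
-- So α is a metered parking function iff cars 2, …, m − 1 park in the ordinary way after
-- car 1 and car m then finds a free spot ≥ aₘ among the spots not taken by cars 2, …, m − 1.
-- Ordinary parking is controlled by counting, in each window of spots [x, U), the occupied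
-- spots and the cars preferring it: if they always fit (Hall's condition) every car parks
-- inside [1, U) when it prefers a spot there, and cars preferring a spot ≥ x end up in [x, n].
-- The parking-function bounds on the two halves of the shuffle give Hall's condition for
-- U = n + 1 when a₁ ≤ k, while the n − k cars above k fill (k, n] and overflow when a₁ > k.
-- If a₁ ≤ j, the shuffle of the cars below k gives Hall's condition for U = k, so spot k
-- stays free and car m parks iff aₘ ≤ k.  If j < a₁, the cars above j together with car 1
-- fill (j, n], so a₁ is the only free spot above j and car m parks iff aₘ ≤ a₁.

module Submission where

open import Defs
open import Data.Bool using (true; false)
open import Data.Nat using (ℕ; zero; suc; _+_; _∸_; _≤_; _<_; _≤?_; _<?_; _≟_; z≤n; s≤s; z<s)
open import Data.Nat.Properties
open import Data.List using (List; []; _∷_; length; _++_; [_]; filter; map; take; applyUpTo)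
open import Data.List.Properties
  using (length-++; length-map; length-filter; filter-++; filter-accept; filter-reject; filter-all; filter-none;
         filter-complete; ++-assoc; take-all; take-[])
open import Data.List.Sort ≤-decTotalOrder using (sort; sort-↭)
open import Data.List.Relation.Unary.All as All using (All; []; _∷_)
open import Data.List.Relation.Unary.All.Properties as AllP using (++⁻ˡ)
open import Data.List.Relation.Unary.Any using (here; there; any?)
open import Data.List.Membership.Propositional using (_∈_; _∉_; find; lose)
open import Data.List.Membership.Propositional.Properties using (∈-filter⁻; ∈-++⁻; ∈-++⁺ˡ)
open import Data.List.Membership.DecPropositional (Data.Nat._≟_) using (_∈?_)
open import Data.List.Relation.Binary.Disjoint.Propositional using (Disjoint)
open import Data.List.Relation.Binary.Permutation.Propositional using (_↭_)
open import Data.List.Relation.Binary.Permutation.Propositional.Properties using (filter-↭; ↭-length)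
open import Data.List.Relation.Binary.Sublist.Propositional using (⊆-refl)
open import Data.List.Relation.Binary.Sublist.Heterogeneous.Properties using (length-mono-≤; ⊆-filter-Sublist)
open import Data.List.Relation.Ternary.Interleaving using ([])
open import Data.List.Relation.Ternary.Interleaving.Propositional using (Interleaving; consˡ; consʳ)
open import Data.List.Relation.Ternary.Interleaving.Properties using (interleave-length)
open import Data.Maybe using (Maybe; just; nothing; _>>=_)
open import Data.Product using (Σ; _×_; _,_; proj₁; proj₂; uncurry)
open import Data.Sum using (_⊎_; inj₁; inj₂)
open import Function using (id)
open import Function.Bundles using (_⇔_; mk⇔; Equivalence)
open import Function.Construct.Composition using (_⇔-∘_)
open import Function.Properties.Equivalence using (⇔-setoid)
open import Level using (0ℓ)
open import Relation.Nullary using (¬_; ¬?; Dec; yes; no; does; contradiction)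
open import Relation.Nullary.Decidable using (_×-dec_; decidable-stable)
open import Relation.Unary using (Pred; Decidable; ∁)
open import Relation.Binary.PropositionalEquality using (_≡_; _≢_; refl; sym; trans; cong; cong₂; subst)
open import Relation.Binary.PropositionalEquality.Properties using (module ≡-Reasoning)
import Relation.Binary.Reasoning.Setoid as SetoidReasoning

-- Counting

count : {A : Set} {P : Pred A 0ℓ} → Decidable P → List A → ℕ
count P? xs = length (filter P? xs)

module _ {A : Set} {P : Pred A 0ℓ} (P? : Decidable P) where

  filter-interleaving : ∀ {l r w} → Interleaving l r w →
    Interleaving (filter P? l) (filter P? r) (filter P? w)
  filter-interleaving [] = []
  filter-interleaving {l = v ∷ _} (consˡ il) with does (P? v)
  ... | true  = consˡ (filter-interleaving il)
  ... | false = filter-interleaving il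
  filter-interleaving {r = v ∷ _} (consʳ il) with does (P? v)
  ... | true  = consʳ (filter-interleaving il)
  ... | false = filter-interleaving il

  count-accept : ∀ {v vs} → P v → count P? (v ∷ vs) ≡ suc (count P? vs)
  count-accept pv = cong length (filter-accept P? pv)

  count-reject : ∀ {v vs} → ¬ P v → count P? (v ∷ vs) ≡ count P? vs
  count-reject ¬pv = cong length (filter-reject P? ¬pv)

  count-++ : ∀ xs ys → count P? (xs ++ ys) ≡ count P? xs + count P? ys
  count-++ xs ys = trans (cong length (filter-++ P? xs ys)) (length-++ (filter P? xs))

  count-↭ : ∀ {xs ys} → xs ↭ ys → count P? xs ≡ count P? ys
  count-↭ p = ↭-length (filter-↭ P? p)

  count-interleaving : ∀ {l r w} → Interleaving l r w → count P? w ≡ count P? l + count P? r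
  count-interleaving il = interleave-length (filter-interleaving il)

  count-all : ∀ {xs} → All P xs → count P? xs ≡ length xs
  count-all ps = cong length (filter-all P? ps)

  count-none : ∀ {xs} → All (∁ P) xs → count P? xs ≡ 0
  count-none ps = cong length (filter-none P? ps)

  count-map : {B : Set} (f : B → A) → ∀ xs → count P? (map f xs) ≡ count (λ v → P? (f v)) xs
  count-map f [] = refl
  count-map f (v ∷ vs) with does (P? (f v))
  ... | true  = cong suc (count-map f vs)
  ... | false = count-map f vs

  count-≤-∷ : ∀ v vs → count P? vs ≤ count P? (v ∷ vs)
  count-≤-∷ v vs = byHead (P? v)
    where
    byHead : Dec (P v) → count P? vs ≤ count P? (v ∷ vs)
    byHead (yes pv) = ≤-trans (n≤1+n (count P? vs)) (≤-reflexive (sym (count-accept pv)))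
    byHead (no ¬pv) = ≤-reflexive (sym (count-reject ¬pv))

  filter-interleaving-left : ∀ {l r w} → Interleaving l r w → All P l → All (∁ P) r → filter P? w ≡ l
  filter-interleaving-left []          _        _          = refl
  filter-interleaving-left (consˡ il) (pv ∷ ps) qs =
    trans (filter-accept P? pv) (cong (_ ∷_) (filter-interleaving-left il ps qs))
  filter-interleaving-left (consʳ il) ps (¬pv ∷ qs) =
    trans (filter-reject P? ¬pv) (filter-interleaving-left il ps qs)

All-interleaving : {A : Set} {P : Pred A 0ℓ} → ∀ {l r w} → Interleaving l r w → All P l → All P r → All P w
All-interleaving []          _        _        = []
All-interleaving (consˡ il) (pv ∷ ps) qs       = pv ∷ All-interleaving il ps qs
All-interleaving (consʳ il) ps        (qv ∷ qs) = qv ∷ All-interleaving il ps qs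

count-mono : {A : Set} {P Q : Pred A 0ℓ} (P? : Decidable P) (Q? : Decidable Q) →
  (∀ {v} → P v → Q v) → ∀ xs → count P? xs ≤ count Q? xs
count-mono P? Q? P⇒Q xs = length-mono-≤ (⊆-filter-Sublist P? Q? (λ { refl → P⇒Q }) (⊆-refl {x = xs}))

count-cong : {A : Set} {P Q : Pred A 0ℓ} (P? : Decidable P) (Q? : Decidable Q) →
  ∀ {xs} → All (λ v → P v ⇔ Q v) xs → count P? xs ≡ count Q? xs
count-cong P? Q? [] = refl
count-cong P? Q? {v ∷ _} (P⇔Q ∷ ps) with P? v | Q? v
... | yes _ | yes _ = cong suc (count-cong P? Q? ps)
... | no  _ | no  _ = count-cong P? Q? ps
... | yes p | no ¬q = contradiction (Equivalence.to P⇔Q p) ¬q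
... | no ¬p | yes q = contradiction (Equivalence.from P⇔Q q) ¬p

-- Windows of spots

interval : ℕ → ℕ → List ℕ
interval x zero    = []
interval x (suc d) = x ∷ interval (suc x) d

length-interval : ∀ x d → length (interval x d) ≡ d
length-interval x zero    = refl
length-interval x (suc d) = cong suc (length-interval (suc x) d)

interval-+ : ∀ x a b → interval x (a + b) ≡ interval x a ++ interval (x + a) b
interval-+ x zero    b = cong (λ y → interval y b) (sym (+-identityʳ x))
interval-+ x (suc a) b =
  cong (x ∷_) (trans (interval-+ (suc x) a b) (cong (λ y → interval (suc x) a ++ interval y b) (sym (+-suc x a))))

∈-interval⁻ : ∀ {s} x d → s ∈ interval x d → x ≤ s × s < x + d
∈-interval⁻ x (suc d) (here refl) = ≤-refl , m<m+n x z<s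
∈-interval⁻ {s} x (suc d) (there s∈) with ∈-interval⁻ (suc x) d s∈
... | x<s , s<x+d = <⇒≤ x<s , subst (s <_) (sym (+-suc x d)) s<x+d

∈-interval⁺ : ∀ {s} x d → x ≤ s → s < x + d → s ∈ interval x d
∈-interval⁺ {s} x zero    x≤s s<x = contradiction (subst (s <_) (+-identityʳ x) s<x) (≤⇒≯ x≤s)
∈-interval⁺ {s} x (suc d) x≤s s<x with x ≟ s
... | yes refl = here refl
... | no  x≢s  = there (∈-interval⁺ (suc x) d (≤∧≢⇒< x≤s x≢s) (subst (s <_) (+-suc x d) s<x))

occupied : List ℕ → ℕ → ℕ → ℕ
occupied O x d = count (_∈? O) (interval x d)

occupied-≤ : ∀ O x d → occupied O x d ≤ d
occupied-≤ O x d = subst (occupied O x d ≤_) (length-interval x d) (length-filter (_∈? O) (interval x d))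

occupied-[] : ∀ x d → occupied [] x d ≡ 0
occupied-[] x d = count-none (_∈? []) {interval x d} (All.universal (λ _ ()) _)

occupied-+ : ∀ O x a b → occupied O x (a + b) ≡ occupied O x a + occupied O (x + a) b
occupied-+ O x a b = trans (cong (count (_∈? O)) (interval-+ x a b)) (count-++ (_∈? O) (interval x a) _)

occupied-full : ∀ O x d → (∀ {s} → x ≤ s → s < x + d → s ∈ O) → occupied O x d ≡ d
occupied-full O x d full =
  trans (count-all (_∈? O) {interval x d} (All.tabulate (λ s∈I → uncurry full (∈-interval⁻ x d s∈I))))
        (length-interval x d)

occupied-full⁻ : ∀ O x d → d ≤ occupied O x d → ∀ {s} → x ≤ s → s < x + d → s ∈ O
occupied-full⁻ O x d d≤ x≤s s<x+d =
  proj₂ (∈-filter⁻ (_∈? O) {xs = interval x d} (subst (_ ∈_) (sym everyOccupied) (∈-interval⁺ x d x≤s s<x+d)))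
  where
  everyOccupied : filter (_∈? O) (interval x d) ≡ interval x d
  everyOccupied = filter-complete (_∈? O) (≤-antisym (length-filter (_∈? O) (interval x d))
                                                     (subst (_≤ occupied O x d) (sym (length-interval x d)) d≤))

occupied-free : ∀ O x d → occupied O x d < d → Σ ℕ λ s → x ≤ s × s < x + d × s ∉ O
occupied-free O x d occ<d with any? (λ s → ¬? (s ∈? O)) (interval x d)
... | yes someFree with find someFree
...   | s , s∈I , s∉O = s , proj₁ (∈-interval⁻ x d s∈I) , proj₂ (∈-interval⁻ x d s∈I) , s∉O
occupied-free O x d occ<d | no noneFree =
  contradiction (occupied-full O x d full) (<⇒≢ occ<d)
  where
  full : ∀ {s} → x ≤ s → s < x + d → s ∈ O
  full {s} x≤s s<x+d = decidable-stable (s ∈? O) (λ s∉O → noneFree (lose (∈-interval⁺ x d x≤s s<x+d) s∉O))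

occupied-∷-out : ∀ p O x d → ¬ (x ≤ p × p < x + d) → occupied (p ∷ O) x d ≡ occupied O x d
occupied-∷-out p O x d p∉I = count-cong (_∈? p ∷ O) (_∈? O) (All.tabulate sameMembership)
  where
  sameMembership : ∀ {s} → s ∈ interval x d → s ∈ p ∷ O ⇔ s ∈ O
  sameMembership s∈I = mk⇔ (λ { (here refl) → contradiction (∈-interval⁻ x d s∈I) p∉I
                               ; (there s∈O) → s∈O })
                           there

occupied-∷-in : ∀ p O x d → p ∉ O → x ≤ p → p < x + d → occupied (p ∷ O) x d ≡ suc (occupied O x d)
occupied-∷-in p O x zero    p∉O x≤p p<x+d = contradiction (subst (p <_) (+-identityʳ x) p<x+d) (≤⇒≯ x≤p)
occupied-∷-in p O x (suc d) p∉O x≤p p<x+d with x ≟ p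
... | yes refl = begin
  occupied (p ∷ O) p (suc d)        ≡⟨ count-accept (_∈? p ∷ O) (here refl) ⟩
  suc (occupied (p ∷ O) (suc p) d)  ≡⟨ cong suc (occupied-∷-out p O (suc p) d (λ (p<p , _) → <-irrefl refl p<p)) ⟩
  suc (occupied O (suc p) d)        ≡⟨ cong suc (sym (count-reject (_∈? O) p∉O)) ⟩
  suc (occupied O p (suc d))        ∎
  where open ≡-Reasoning
... | no x≢p = headAgrees (x ∈? O)
  where
  ih : occupied (p ∷ O) (suc x) d ≡ suc (occupied O (suc x) d)
  ih = occupied-∷-in p O (suc x) d p∉O (≤∧≢⇒< x≤p x≢p) (subst (p <_) (+-suc x d) p<x+d)
  headAgrees : Dec (x ∈ O) → occupied (p ∷ O) x (suc d) ≡ suc (occupied O x (suc d))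
  headAgrees (yes x∈O) =
    trans (count-accept (_∈? p ∷ O) (there x∈O)) (cong suc (trans ih (sym (count-accept (_∈? O) x∈O))))
  headAgrees (no  x∉O) =
    trans (count-reject (_∈? p ∷ O) x∉p∷O) (trans ih (cong suc (sym (count-reject (_∈? O) x∉O))))
    where
    x∉p∷O : x ∉ p ∷ O
    x∉p∷O (here x≡p) = x≢p x≡p
    x∉p∷O (there x∈O) = x∉O x∈O

occupied-∷-mono : ∀ p O x d → occupied O x d ≤ occupied (p ∷ O) x d
occupied-∷-mono p O x d = count-mono (_∈? O) (_∈? p ∷ O) there (interval x d)

occupied-[-]-outside : ∀ a x d → ¬ (x ≤ a × a < x + d) → occupied [ a ] x d ≡ 0
occupied-[-]-outside a x d a∉window = trans (occupied-∷-out a [] x d a∉window) (occupied-[] x d)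

occupied-[-]-inside : ∀ a x d → x ≤ a → a < x + d → occupied [ a ] x d ≡ 1
occupied-[-]-inside a x d x≤a a<x+d = trans (occupied-∷-in a [] x d (λ ()) x≤a a<x+d) (cong suc (occupied-[] x d))

occupied-[-]-≤ : ∀ a x d → occupied [ a ] x d ≤ 1
occupied-[-]-≤ a x d with x ≤? a | a <? x + d
... | yes x≤a | yes a<x+d = ≤-reflexive (occupied-[-]-inside a x d x≤a a<x+d)
... | no  x≰a | _         = ≤-trans (≤-reflexive (occupied-[-]-outside a x d (λ (x≤a , _) → x≰a x≤a))) z≤n
... | yes _   | no  a≮x+d = ≤-trans (≤-reflexive (occupied-[-]-outside a x d (λ (_ , a<x+d) → a≮x+d a<x+d))) z≤n

occupied-[-]-below : ∀ a x d → a < x → occupied [ a ] x d ≡ 0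
occupied-[-]-below a x d a<x = occupied-[-]-outside a x d (λ (x≤a , _) → <⇒≱ a<x x≤a)

-- Ordinary parking

map-applyUpTo-interval : ∀ (g f : ℕ → ℕ) x d → (∀ i → g (f i) ≡ x + i) → map g (applyUpTo f d) ≡ interval x d
map-applyUpTo-interval g f x zero    _ = refl
map-applyUpTo-interval g f x (suc d) h =
  cong₂ _∷_ (trans (h 0) (+-identityʳ x))
            (map-applyUpTo-interval g (λ i → f (suc i)) (suc x) d (λ i → trans (h (suc i)) (+-suc x i)))

spotsFrom≡interval : ∀ n a → spotsFrom n a ≡ interval a (suc n ∸ a)
spotsFrom≡interval n a = map-applyUpTo-interval (a +_) id a (suc n ∸ a) (λ _ → refl)

record FirstFreeFrom (O : List ℕ) (a p : ℕ) : Set where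
  field
    a≤p         : a ≤ p
    p∉O         : p ∉ O
    skippedTaken : ∀ {s} → a ≤ s → s < p → s ∈ O

firstFree-just : ∀ O a c {p} → firstFree O (interval a c) ≡ just p → FirstFreeFrom O a p × p < a + c
firstFree-just O a (suc c) {p} eq with a ∈? O
firstFree-just O a (suc c) refl | no a∉O =
  record { a≤p = ≤-refl ; p∉O = a∉O ; skippedTaken = λ a≤s s<a → contradiction a≤s (<⇒≱ s<a) } , m<m+n a z<s
firstFree-just O a (suc c) {p} eq | yes a∈O with firstFree-just O (suc a) c eq
... | ff , p<1+a+c =
  record { a≤p = <⇒≤ a<p ; p∉O = p∉O ; skippedTaken = taken } , subst (p <_) (sym (+-suc a c)) p<1+a+c
  where
  open FirstFreeFrom ff renaming (a≤p to a<p)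
  taken : ∀ {s} → a ≤ s → s < p → s ∈ O
  taken {s} a≤s s<p with a ≟ s
  ... | yes refl = a∈O
  ... | no a≢s   = skippedTaken (≤∧≢⇒< a≤s a≢s) s<p

firstFree-nothing : ∀ O a c → firstFree O (interval a c) ≡ nothing → ∀ {s} → a ≤ s → s < a + c → s ∈ O
firstFree-nothing O a zero    eq a≤s s<a+c = contradiction (subst (_ <_) (+-identityʳ a) s<a+c) (≤⇒≯ a≤s)
firstFree-nothing O a (suc c) eq {s} a≤s s<a+c with a ∈? O | ∈-interval⁺ a (suc c) a≤s s<a+c
... | yes a∈O | here refl = a∈O
... | yes a∈O | there s∈I = uncurry (firstFree-nothing O (suc a) c eq) (∈-interval⁻ (suc a) c s∈I)

<+∸⇒< : ∀ {a p} b → a ≤ p → p < a + (b ∸ a) → p < b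
<+∸⇒< {a} {p} b a≤p p< with a ≤? b
... | yes a≤b = subst (p <_) (m+[n∸m]≡n a≤b) p<
... | no  a≰b = contradiction (subst (λ z → p < a + z) (m≤n⇒m∸n≡0 (≰⇒≥ a≰b)) p<)
                              (≤⇒≯ (subst (_≤ p) (sym (+-identityʳ a)) a≤p))

parksAt : ∀ n O a {p} → firstFree O (spotsFrom n a) ≡ just p → FirstFreeFrom O a p × p ≤ n
parksAt n O a eq with firstFree-just O a (suc n ∸ a) (trans (cong (firstFree O) (sym (spotsFrom≡interval n a))) eq)
... | ff , p< = ff , ≤-pred (<+∸⇒< (suc n) (FirstFreeFrom.a≤p ff) p<)

parksNowhere : ∀ n O a → firstFree O (spotsFrom n a) ≡ nothing → ∀ {s} → a ≤ s → s ≤ n → s ∈ O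
parksNowhere n O a eq {s} a≤s s≤n =
  firstFree-nothing O a (suc n ∸ a) (trans (cong (firstFree O) (sym (spotsFrom≡interval n a))) eq) a≤s
    (subst (s <_) (sym (m+[n∸m]≡n (≤-trans a≤s (m≤n⇒m≤1+n s≤n)))) (s≤s s≤n))

parksAtPreference : ∀ n a → a ≤ n → firstFree [] (spotsFrom n a) ≡ just a
parksAtPreference n a a≤n rewrite spotsFrom≡interval n a | +-∸-assoc 1 a≤n = refl

parkAll : ℕ → List ℕ → List ℕ → Maybe (List ℕ)
parkAll n O []       = just O
parkAll n O (a ∷ as) with firstFree O (spotsFrom n a)
... | nothing = nothing
... | just p  = parkAll n (p ∷ O) as

-- While at most t + 1 cars have arrived, no car has left yet.
meteredRun-parkAll : ∀ t n O xs ys → length O + length xs ≤ suc t →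
  meteredRun t n O (xs ++ ys) ≡ (parkAll n O xs >>= λ F → meteredRun t n F ys)
meteredRun-parkAll t n O []       ys _ = refl
meteredRun-parkAll t n O (a ∷ as) ys bound
  rewrite take-all t O (≤-pred (≤-trans (m<m+n (length O) z<s) bound))
  with firstFree O (spotsFrom n a)
... | nothing = refl
... | just p  = meteredRun-parkAll t n (p ∷ O) as ys (subst (_≤ suc t) (+-suc (length O) (length as)) bound)

parkAll-shape : ∀ n O xs {F} → parkAll n O xs ≡ just F →
  Σ (List ℕ) λ Q → F ≡ Q ++ O × length Q ≡ length xs × Disjoint O Q
parkAll-shape n O []       refl = [] , refl , refl , λ ()
parkAll-shape n O (a ∷ as) eq with firstFree O (spotsFrom n a) in ff
parkAll-shape n O (a ∷ as) eq | just p with parkAll-shape n (p ∷ O) as eq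
... | Q , F≡ , lengthQ , disjoint =
  Q ++ [ p ] , trans F≡ (sym (++-assoc Q [ p ] O)) ,
  trans (length-++ Q) (trans (+-comm (length Q) 1) (cong suc lengthQ)) , disjoint′
  where
  disjoint′ : Disjoint O (Q ++ [ p ])
  disjoint′ (v∈O , v∈Q++p) with ∈-++⁻ Q v∈Q++p
  ... | inj₁ v∈Q        = disjoint (there v∈O , v∈Q)
  ... | inj₂ (here refl) = FirstFreeFrom.p∉O (proj₁ (parksAt n O a ff)) v∈O

count≥ : ℕ → List ℕ → ℕ
count≥ x = count (x ≤?_)

parkAll-fills : ∀ n O xs {F} x d → parkAll n O xs ≡ just F → x + d ≡ suc n →
  occupied O x d + count≥ x xs ≤ occupied F x d
parkAll-fills n O []       x d refl _ = ≤-reflexive (+-identityʳ _)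
parkAll-fills n O (a ∷ as) {F} x d eq x+d≡1+n with firstFree O (spotsFrom n a) in ff
... | just p = byPreference (x ≤? a)
  where
  open ≤-Reasoning
  spec : FirstFreeFrom O a p
  spec = proj₁ (parksAt n O a ff)
  ih : occupied (p ∷ O) x d + count≥ x as ≤ occupied F x d
  ih = parkAll-fills n (p ∷ O) as x d eq x+d≡1+n
  byPreference : Dec (x ≤ a) → occupied O x d + count≥ x (a ∷ as) ≤ occupied F x d
  byPreference (yes x≤a) = begin
    occupied O x d + count≥ x (a ∷ as)   ≡⟨ cong (occupied O x d +_) (count-accept (x ≤?_) x≤a) ⟩
    occupied O x d + suc (count≥ x as)   ≡⟨ +-suc (occupied O x d) _ ⟩
    suc (occupied O x d) + count≥ x as   ≡⟨ cong (_+ count≥ x as) (sym (occupied-∷-in p O x d (FirstFreeFrom.p∉O spec)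
                                              (≤-trans x≤a (FirstFreeFrom.a≤p spec))
                                              (subst (p <_) (sym x+d≡1+n) (s≤s (proj₂ (parksAt n O a ff)))))) ⟩
    occupied (p ∷ O) x d + count≥ x as   ≤⟨ ih ⟩
    occupied F x d                       ∎
  byPreference (no x≰a) = begin
    occupied O x d + count≥ x (a ∷ as)   ≡⟨ cong (occupied O x d +_) (count-reject (x ≤?_) x≰a) ⟩
    occupied O x d + count≥ x as         ≤⟨ +-monoˡ-≤ (count≥ x as) (occupied-∷-mono p O x d) ⟩
    occupied (p ∷ O) x d + count≥ x as   ≤⟨ ih ⟩
    occupied F x d                       ∎

parkAll-fullAbove : ∀ n O xs {F} y → parkAll n O xs ≡ just F → y ≤ n →
  n ∸ y ≤ occupied O (suc y) (n ∸ y) + count≥ (suc y) xs → ∀ {s} → y < s → s ≤ n → s ∈ F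
parkAll-fullAbove n O xs {F} y parked y≤n enough {s} y<s s≤n =
  occupied-full⁻ F (suc y) (n ∸ y) (≤-trans enough (parkAll-fills n O xs (suc y) (n ∸ y) parked window))
                 y<s (subst (s <_) (sym window) (s≤s s≤n))
  where
  window : suc y + (n ∸ y) ≡ suc n
  window = cong suc (m+[n∸m]≡n y≤n)

-- Hall's condition

countIn : ℕ → ℕ → List ℕ → ℕ
countIn x U = count (λ v → x ≤? v ×-dec v <? U)

-- A window [x, U) is given by x and its length d, so that no truncated subtraction occurs.
Hall : ℕ → List ℕ → List ℕ → Set
Hall U O R = ∀ x d → x + d ≡ U → occupied O x d + countIn x U R ≤ d

module _ {U : ℕ} {O : List ℕ} {a : ℕ} {R : List ℕ} (hall : Hall U O (a ∷ R)) where

  hall-free : a < U → Σ ℕ λ s → a ≤ s × s < U × s ∉ O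
  hall-free a<U = relocate (occupied-free O a (U ∸ a) occupied<)
    where
    a+[U∸a]≡U : a + (U ∸ a) ≡ U
    a+[U∸a]≡U = m+[n∸m]≡n (<⇒≤ a<U)
    occupied< : occupied O a (U ∸ a) < U ∸ a
    occupied< = begin-strict
      occupied O a (U ∸ a)                             <⟨ m<m+n _ z<s ⟩
      occupied O a (U ∸ a) + suc (countIn a U R)       ≡⟨ cong (occupied O a (U ∸ a) +_)
                                                              (sym (count-accept _ {vs = R} (≤-refl , a<U))) ⟩
      occupied O a (U ∸ a) + countIn a U (a ∷ R)       ≤⟨ hall a (U ∸ a) a+[U∸a]≡U ⟩
      U ∸ a                                            ∎
      where open ≤-Reasoning
    relocate : (Σ ℕ λ s → a ≤ s × s < a + (U ∸ a) × s ∉ O) → Σ ℕ λ s → a ≤ s × s < U × s ∉ O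
    relocate (s , a≤s , s< , s∉O) = s , a≤s , subst (s <_) a+[U∸a]≡U s< , s∉O

  hall-parksBelow : ∀ {p} → FirstFreeFrom O a p → a < U → p < U
  hall-parksBelow {p} spec a<U with hall-free a<U | p <? U
  ... | _ | yes p<U = p<U
  ... | s , a≤s , s<U , s∉O | no p≮U =
    contradiction (FirstFreeFrom.skippedTaken spec a≤s (<-≤-trans s<U (≮⇒≥ p≮U))) s∉O

  -- If x > a, the spots in [a, x) were all skipped by the car, so Hall's condition at a applies.
  roomAfterParking : ∀ {p} → FirstFreeFrom O a p → ∀ x d → x + d ≡ U → x ≤ p → p < U →
    occupied O x d + suc (countIn x U R) ≤ d
  roomAfterParking {p} spec x d x+d≡U x≤p p<U = byPreference (x ≤? a)
    where
    open FirstFreeFrom spec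
    open ≤-Reasoning
    byPreference : Dec (x ≤ a) → occupied O x d + suc (countIn x U R) ≤ d
    byPreference (yes x≤a) =
      subst (λ c → occupied O x d + c ≤ d)
            (count-accept (λ v → x ≤? v ×-dec v <? U) {vs = R} (x≤a , ≤-<-trans a≤p p<U))
            (hall x d x+d≡U)
    byPreference (no x≰a) = +-cancelˡ-≤ g _ _ (begin
      g + (occupied O x d + suc (countIn x U R))  ≡⟨ sym (+-assoc g _ _) ⟩
      g + occupied O x d + suc (countIn x U R)    ≡⟨ cong (_+ suc (countIn x U R)) (sym gapTaken) ⟩
      occupied O a (g + d) + suc (countIn x U R)  ≤⟨ +-monoʳ-≤ (occupied O a (g + d)) (s≤s fewerCars) ⟩
      occupied O a (g + d) + suc (countIn a U R)  ≡⟨ cong (occupied O a (g + d) +_) (sym (count-accept _ {vs = R} (≤-refl , a<U))) ⟩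
      occupied O a (g + d) + countIn a U (a ∷ R)  ≤⟨ hall a (g + d) a+[g+d]≡U ⟩
      g + d                                       ∎)
      where
      a<x : a < x
      a<x = ≰⇒> x≰a
      a<U : a < U
      a<U = <-≤-trans a<x (≤-trans x≤p (<⇒≤ p<U))
      g : ℕ
      g = x ∸ a
      a+g≡x : a + g ≡ x
      a+g≡x = m+[n∸m]≡n (<⇒≤ a<x)
      a+[g+d]≡U : a + (g + d) ≡ U
      a+[g+d]≡U = trans (sym (+-assoc a g d)) (trans (cong (_+ d) a+g≡x) x+d≡U)
      gapTaken : occupied O a (g + d) ≡ g + occupied O x d
      gapTaken = trans (occupied-+ O a g d)
        (cong₂ _+_ (occupied-full O a g (λ {s} a≤s s<a+g → skippedTaken a≤s (<-≤-trans (subst (s <_) a+g≡x s<a+g) x≤p)))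
                   (cong (λ y → occupied O y d) a+g≡x))
      fewerCars : countIn x U R ≤ countIn a U R
      fewerCars = count-mono _ _ (λ (x≤v , v<U) → ≤-trans (<⇒≤ a<x) x≤v , v<U) R

  roomOutside : ∀ p x d → x + d ≡ U → ¬ (x ≤ p × p < x + d) → occupied (p ∷ O) x d + countIn x U R ≤ d
  roomOutside p x d x+d≡U p∉window = begin
    occupied (p ∷ O) x d + countIn x U R      ≡⟨ cong (_+ countIn x U R) (occupied-∷-out p O x d p∉window) ⟩
    occupied O x d + countIn x U R            ≤⟨ +-monoʳ-≤ (occupied O x d) (count-≤-∷ _ a R) ⟩
    occupied O x d + countIn x U (a ∷ R)      ≤⟨ hall x d x+d≡U ⟩
    d                                         ∎
    where open ≤-Reasoning

  hall-step : ∀ {p} → FirstFreeFrom O a p → Hall U (p ∷ O) R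
  hall-step {p} spec x d x+d≡U with x ≤? p | p <? U
  ... | yes x≤p | yes p<U = begin
    occupied (p ∷ O) x d + countIn x U R      ≡⟨ cong (_+ countIn x U R) (occupied-∷-in p O x d (FirstFreeFrom.p∉O spec) x≤p
                                                     (subst (p <_) (sym x+d≡U) p<U)) ⟩
    suc (occupied O x d) + countIn x U R      ≡⟨ sym (+-suc (occupied O x d) _) ⟩
    occupied O x d + suc (countIn x U R)      ≤⟨ roomAfterParking spec x d x+d≡U x≤p p<U ⟩
    d                                         ∎
    where open ≤-Reasoning
  ... | no x≰p | _      = roomOutside p x d x+d≡U (λ (x≤p , _) → x≰p x≤p)
  ... | yes _  | no p≮U = roomOutside p x d x+d≡U (λ (_ , p<x+d) → p≮U (subst (p <_) x+d≡U p<x+d))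

hall-parks : ∀ n O R → Hall (suc n) O R → All (_≤ n) R → Σ (List ℕ) λ F → parkAll n O R ≡ just F
hall-parks n O []       _    _           = O , refl
hall-parks n O (a ∷ R) hall (a≤n ∷ R≤n) with firstFree O (spotsFrom n a) in ff
... | just p  = hall-parks n (p ∷ O) R (hall-step hall (proj₁ (parksAt n O a ff))) R≤n
... | nothing with hall-free hall (s≤s a≤n)
...   | s , a≤s , s≤n , s∉O = contradiction (parksNowhere n O a ff a≤s (≤-pred s≤n)) s∉O

hall-avoids : ∀ n k O R {F} → Hall k O R → All (_≢ k) R → k ∉ O → parkAll n O R ≡ just F → k ∉ F
hall-avoids n k O []       _    _            k∉O refl = k∉O
hall-avoids n k O (a ∷ R) hall (a≢k ∷ R≢k) k∉O eq with firstFree O (spotsFrom n a) in ff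
... | just p = hall-avoids n k (p ∷ O) R (hall-step hall spec) R≢k k∉p∷O eq
  where
  spec : FirstFreeFrom O a p
  spec = proj₁ (parksAt n O a ff)
  p≢k : p ≢ k
  p≢k refl with a <? p
  ... | yes a<p = <-irrefl refl (hall-parksBelow hall spec a<p)
  ... | no  a≮p = a≢k (≤-antisym (FirstFreeFrom.a≤p spec) (≮⇒≥ a≮p))
  k∉p∷O : k ∉ p ∷ O
  k∉p∷O (here k≡p) = p≢k (sym k≡p)
  k∉p∷O (there k∈O) = k∉O k∈O

-- Metered parking with t = m − 2

HasFreeSpot : ℕ → List ℕ → ℕ → Set
HasFreeSpot n Q a = Σ ℕ λ s → a ≤ s × s ≤ n × s ∉ Q

isJust-firstFree⇔ : ∀ n Q a → IsJust (firstFree Q (spotsFrom n a)) ⇔ HasFreeSpot n Q a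
isJust-firstFree⇔ n Q a with firstFree Q (spotsFrom n a) in ff
... | just p with parksAt n Q a ff
...   | spec , p≤n = mk⇔ (λ _ → p , FirstFreeFrom.a≤p spec , p≤n , FirstFreeFrom.p∉O spec) (λ _ → isJust p)
isJust-firstFree⇔ n Q a | nothing =
  mk⇔ (λ ()) (λ (s , a≤s , s≤n , s∉Q) → contradiction (parksNowhere n Q a ff a≤s s≤n) s∉Q)

hasFreeSpot⇔ : ∀ {n Q c a} → c ≤ n → c ∉ Q → (∀ {s} → c < s → s ≤ n → s ∈ Q) → HasFreeSpot n Q a ⇔ a ≤ c
hasFreeSpot⇔ {n} {Q} {c} {a} c≤n c∉Q aboveTaken = mk⇔ to (λ a≤c → c , a≤c , c≤n , c∉Q)
  where
  to : HasFreeSpot n Q a → a ≤ c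
  to (s , a≤s , s≤n , s∉Q) with s ≤? c
  ... | yes s≤c = ≤-trans a≤s s≤c
  ... | no  s≰c = contradiction (aboveTaken (≰⇒> s≰c) s≤n) s∉Q

take-length-++ : ∀ (xs ys : List ℕ) → take (length xs) (xs ++ ys) ≡ xs
take-length-++ []       ys = refl
take-length-++ (x ∷ xs) ys = cong (x ∷_) (take-length-++ xs ys)

isJust-meteredRun-lastCar : ∀ t n F a → IsJust (meteredRun t n F [ a ]) ⇔ IsJust (firstFree (take t F) (spotsFrom n a))
isJust-meteredRun-lastCar t n F a with firstFree (take t F) (spotsFrom n a)
... | nothing = mk⇔ (λ ()) (λ ())
... | just p  = mk⇔ (λ _ → isJust p) (λ _ → isJust (p ∷ F))

module _ (n a₁ aₘ : ℕ) (mid : List ℕ) (a₁≤n : a₁ ≤ n) where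

  meteredRun-firstAndLast : meteredRun (length mid) n [] (a₁ ∷ mid ++ [ aₘ ]) ≡
                            (parkAll n [ a₁ ] mid >>= λ F → meteredRun (length mid) n F [ aₘ ])
  meteredRun-firstAndLast rewrite take-[] {A = ℕ} (length mid) | parksAtPreference n a₁ a₁≤n =
    meteredRun-parkAll (length mid) n [ a₁ ] mid [ aₘ ] ≤-refl

  ¬metered-jam : parkAll n [ a₁ ] mid ≡ nothing → ¬ MeteredPF (length mid) n (a₁ ∷ mid ++ [ aₘ ])
  ¬metered-jam jam mpf with subst IsJust (trans meteredRun-firstAndLast (cong (_>>= _) jam)) mpf
  ... | ()

  metered⇔lastCarParks : ∀ {F Q} → parkAll n [ a₁ ] mid ≡ just F → F ≡ Q ++ [ a₁ ] → length Q ≡ length mid →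
    MeteredPF (length mid) n (a₁ ∷ mid ++ [ aₘ ]) ⇔ HasFreeSpot n Q aₘ
  metered⇔lastCarParks {F} {Q} parked F≡ |Q|≡ = begin
    MeteredPF (length mid) n (a₁ ∷ mid ++ [ aₘ ])
      ≡⟨ cong IsJust (trans meteredRun-firstAndLast (cong (_>>= _) parked)) ⟩
    IsJust (meteredRun (length mid) n F [ aₘ ])
      ≈⟨ isJust-meteredRun-lastCar (length mid) n F aₘ ⟩
    IsJust (firstFree (take (length mid) F) (spotsFrom n aₘ))
      ≡⟨ cong (λ O → IsJust (firstFree O (spotsFrom n aₘ))) remaining ⟩
    IsJust (firstFree Q (spotsFrom n aₘ))
      ≈⟨ isJust-firstFree⇔ n Q aₘ ⟩
    HasFreeSpot n Q aₘ ∎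
    where
    open SetoidReasoning (⇔-setoid 0ℓ)
    remaining : take (length mid) F ≡ Q
    remaining = trans (cong₂ take (sym |Q|≡) F≡) (take-length-++ Q [ a₁ ])

-- Parking functions and their shuffles

count≥-boundedFrom : ∀ b c x → BoundedFrom b c → count≥ x c ≤ b + length c ∸ x
count≥-boundedFrom b []       x _            = z≤n
count≥-boundedFrom b (y ∷ ys) x (y≤b , rest) = byHead (x ≤? y)
  where
  open ≤-Reasoning
  byHead : Dec (x ≤ y) → count≥ x (y ∷ ys) ≤ b + length (y ∷ ys) ∸ x
  byHead (yes x≤y) = begin
    count≥ x (y ∷ ys)         ≡⟨ count-accept (x ≤?_) x≤y ⟩
    suc (count≥ x ys)         ≤⟨ s≤s (length-filter (x ≤?_) ys) ⟩
    suc (length ys)           ≤⟨ m≤n+m (suc (length ys)) (b ∸ x) ⟩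
    b ∸ x + suc (length ys)   ≡⟨ sym (+-∸-comm (suc (length ys)) (≤-trans x≤y y≤b)) ⟩
    b + suc (length ys) ∸ x   ∎
  byHead (no x≰y) = begin
    count≥ x (y ∷ ys)         ≡⟨ count-reject (x ≤?_) x≰y ⟩
    count≥ x ys               ≤⟨ count≥-boundedFrom (suc b) ys x rest ⟩
    suc b + length ys ∸ x     ≡⟨ cong (_∸ x) (sym (+-suc b (length ys))) ⟩
    b + suc (length ys) ∸ x   ∎

count≥-PF : ∀ {r s c} → PF r s c → ∀ x → count≥ x c ≤ suc s ∸ x
count≥-PF {r} {s} {c} (|c|≡r , r≤s , _ , bounded) x = begin
  count≥ x c                             ≡⟨ sym (count-↭ (x ≤?_) (sort-↭ c)) ⟩
  count≥ x (sort c)                      ≤⟨ count≥-boundedFrom (suc (s ∸ r)) (sort c) x bounded ⟩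
  suc (s ∸ r) + length (sort c) ∸ x      ≡⟨ cong (λ l → suc (s ∸ r) + l ∸ x) (trans (↭-length (sort-↭ c)) |c|≡r) ⟩
  suc (s ∸ r + r) ∸ x                    ≡⟨ cong (λ z → suc z ∸ x) (m∸n+n≡m r≤s) ⟩
  suc s ∸ x                              ∎
  where open ≤-Reasoning

count≥-shift : ∀ c b x → count≥ x (map (λ v → v + c) b) ≤ count≥ (x ∸ c) b
count≥-shift c b x = begin
  count≥ x (map (λ v → v + c) b)        ≡⟨ count-map (x ≤?_) (λ v → v + c) b ⟩
  count (λ v → x ≤? v + c) b            ≤⟨ count-mono _ _ (λ {v} x≤v+c → subst (x ∸ c ≤_) (m+n∸n≡m v c) (∸-monoˡ-≤ c x≤v+c)) b ⟩
  count≥ (x ∸ c) b                      ∎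
  where open ≤-Reasoning

count≥-shift-all : ∀ c b y → All (1 ≤_) b → y ≤ suc c → count≥ y (map (λ v → v + c) b) ≡ length b
count≥-shift-all c b y positive y≤1+c =
  trans (count-map (y ≤?_) (λ v → v + c) b) (count-all _ (All.map (λ 1≤v → ≤-trans y≤1+c (+-monoˡ-≤ c 1≤v)) positive))

-- Sh without its length condition.
record ShuffleOfPF (c r : ℕ) (w : List ℕ) : Set where
  field
    low high : List ℕ
    low-PF   : PF (length low) (c ∸ 1) low
    high-PF  : PF r r high
    shuffle  : Interleaving low (map (λ v → v + c) high) w

sh⇒shuffleOfPF : ∀ {M N k w} → Sh M N k w → ShuffleOfPF k (N ∸ k) w
sh⇒shuffleOfPF (γ , b , _ , γ-PF , b-PF , il) =
  record { low = γ ; high = b ; low-PF = γ-PF ; high-PF = b-PF ; shuffle = il }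

PF-entries : ∀ {r s c} → PF r s c → All (λ v → 1 ≤ v × v ≤ s) c
PF-entries (_ , _ , entries , _) = entries

module _ {c r : ℕ} {w : List ℕ} (S : ShuffleOfPF (suc c) r w) where
  open ShuffleOfPF S

  private
    shifted : List ℕ
    shifted = map (λ v → v + suc c) high

    low≤c : All (_≤ c) low
    low≤c = All.map proj₂ (PF-entries low-PF)

    shifted>1+c : All (suc c <_) shifted
    shifted>1+c = AllP.map⁺ (All.map (λ (1≤v , _) → +-monoˡ-≤ (suc c) 1≤v) (PF-entries high-PF))

  filter-shuffle : filter (_<? suc c) w ≡ low
  filter-shuffle = filter-interleaving-left (_<? suc c) shuffle (All.map s≤s low≤c)
                     (All.map (λ 1+c<v v<1+c → <-asym 1+c<v v<1+c) shifted>1+c)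

  shuffle-≢ : All (_≢ suc c) w
  shuffle-≢ = All-interleaving shuffle (All.map (λ v≤c v≡1+c → <-irrefl v≡1+c (s≤s v≤c)) low≤c)
                                       (All.map (λ 1+c<v v≡1+c → <-irrefl (sym v≡1+c) 1+c<v) shifted>1+c)

  count≥-shuffle : ∀ y → y ≤ suc (suc c) → count≥ y w ≡ count≥ y low + r
  count≥-shuffle y y≤2+c =
    trans (count-interleaving (y ≤?_) shuffle)
          (cong (count≥ y low +_) (trans (count≥-shift-all (suc c) high y (All.map proj₁ (PF-entries high-PF)) y≤2+c)
                                         (proj₁ high-PF)))

  countIn-shuffle : ∀ x → countIn x (suc c) w ≤ count≥ x low
  countIn-shuffle x = begin
    countIn x (suc c) w                               ≡⟨ count-interleaving _ shuffle ⟩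
    countIn x (suc c) low + countIn x (suc c) shifted ≡⟨ cong (countIn x (suc c) low +_) noneBelow ⟩
    countIn x (suc c) low + 0                         ≡⟨ +-identityʳ _ ⟩
    countIn x (suc c) low                             ≤⟨ count-mono _ _ proj₁ low ⟩
    count≥ x low                                      ∎
    where
    open ≤-Reasoning
    noneBelow : countIn x (suc c) shifted ≡ 0
    noneBelow = count-none _ (All.map (λ 1+c<v (_ , v<1+c) → <-asym 1+c<v v<1+c) shifted>1+c)

  shuffle-room : ∀ a x d → a ≤ suc c → x + d ≡ suc (suc c + r) → occupied [ a ] x d + count≥ x w ≤ d
  shuffle-room a x d a≤1+c x+d≡ = byWindow (x ≤? suc c)
    where
    open ≤-Reasoning
    d≡ : d ≡ suc (suc c + r) ∸ x
    d≡ = trans (sym (m+n∸m≡n x d)) (cong (_∸ x) x+d≡)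
    split : count≥ x w ≡ count≥ x low + count≥ x shifted
    split = count-interleaving (x ≤?_) shuffle
    byWindow : Dec (x ≤ suc c) → occupied [ a ] x d + count≥ x w ≤ d
    byWindow (yes x≤1+c) = begin
      occupied [ a ] x d + count≥ x w                       ≡⟨ cong (occupied [ a ] x d +_) split ⟩
      occupied [ a ] x d + (count≥ x low + count≥ x shifted) ≤⟨ +-mono-≤ (occupied-[-]-≤ a x d)
                                                                          (+-mono-≤ (count≥-PF low-PF x) fewShifted) ⟩
      suc ((suc c ∸ x) + r)                                 ≡⟨ cong suc (sym (+-∸-comm r x≤1+c)) ⟩
      suc ((suc c + r) ∸ x)                                 ≡⟨ sym (+-∸-assoc 1 (≤-trans x≤1+c (m≤m+n (suc c) r))) ⟩
      suc (suc c + r) ∸ x                                   ≡⟨ sym d≡ ⟩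
      d                                                     ∎
      where
      fewShifted : count≥ x shifted ≤ r
      fewShifted = begin
        count≥ x shifted  ≤⟨ length-filter (x ≤?_) shifted ⟩
        length shifted    ≡⟨ length-map _ high ⟩
        length high       ≡⟨ proj₁ high-PF ⟩
        r                 ∎
    byWindow (no x≰1+c) = begin
      occupied [ a ] x d + count≥ x w                        ≡⟨ cong₂ _+_ (occupied-[-]-below a x d (≤-<-trans a≤1+c 1+c<x)) split ⟩
      count≥ x low + count≥ x shifted                        ≤⟨ +-mono-≤ (count≥-PF low-PF x) (count≥-shift (suc c) high x) ⟩
      (suc c ∸ x) + count≥ (x ∸ suc c) high                  ≤⟨ +-mono-≤ (≤-reflexive (m≤n⇒m∸n≡0 (<⇒≤ 1+c<x)))
                                                                          (count≥-PF high-PF (x ∸ suc c)) ⟩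
      suc r ∸ (x ∸ suc c)                                    ≡⟨ sym ([m+n]∸[m+o]≡n∸o (suc c) (suc r) (x ∸ suc c)) ⟩
      (suc c + suc r) ∸ (suc c + (x ∸ suc c))                ≡⟨ cong₂ _∸_ (+-suc (suc c) r) (m+[n∸m]≡n (<⇒≤ 1+c<x)) ⟩
      suc (suc c + r) ∸ x                                    ≡⟨ sym d≡ ⟩
      d                                                      ∎
      where
      1+c<x : suc c < x
      1+c<x = ≰⇒> x≰1+c

∸-telescope : ∀ {a b c} → a ≤ b → b ≤ c → (b ∸ a) + (c ∸ b) ≡ c ∸ a
∸-telescope {a} {b} {c} a≤b b≤c = begin
  (b ∸ a) + (c ∸ b)   ≡⟨ +-comm (b ∸ a) (c ∸ b) ⟩
  (c ∸ b) + (b ∸ a)   ≡⟨ sym (+-∸-assoc (c ∸ b) a≤b) ⟩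
  (c ∸ b) + b ∸ a     ≡⟨ cong (_∸ a) (m∸n+n≡m b≤c) ⟩
  c ∸ a               ∎
  where open ≡-Reasoning

module Setting (n k′ a₁ aₘ : ℕ) (mid : List ℕ) (S : ShuffleOfPF (suc k′) (n ∸ suc k′) mid)
               (k≤n : suc k′ ≤ n) (a₁≤n : a₁ ≤ n) (mid≤n : All (_≤ n) mid) where

  k : ℕ
  k = suc k′

  MP : Set
  MP = MeteredPF (length mid) n (a₁ ∷ mid ++ [ aₘ ])

  carsAbove-k : n ∸ k ≤ count≥ (suc k) mid
  carsAbove-k = subst (n ∸ k ≤_) (sym (count≥-shuffle S (suc k) ≤-refl)) (m≤n+m (n ∸ k) _)

  ¬metered-a₁>k : k < a₁ → ¬ MP
  ¬metered-a₁>k k<a₁ with parkAll n [ a₁ ] mid in parked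
  ... | nothing = ¬metered-jam n a₁ aₘ mid a₁≤n parked
  ... | just F  = λ _ → <-irrefl refl (begin-strict
    n ∸ k                                                  ≤⟨ carsAbove-k ⟩
    count≥ (suc k) mid                                     <⟨ n<1+n _ ⟩
    1 + count≥ (suc k) mid                                 ≡⟨ cong (_+ count≥ (suc k) mid) (sym a₁-inWindow) ⟩
    occupied [ a₁ ] (suc k) (n ∸ k) + count≥ (suc k) mid   ≤⟨ parkAll-fills n [ a₁ ] mid (suc k) (n ∸ k) parked window ⟩
    occupied F (suc k) (n ∸ k)                             ≤⟨ occupied-≤ F (suc k) (n ∸ k) ⟩
    n ∸ k                                                  ∎)
    where
    open ≤-Reasoning
    window : suc k + (n ∸ k) ≡ suc n
    window = cong suc (m+[n∸m]≡n k≤n)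
    a₁-inWindow : occupied [ a₁ ] (suc k) (n ∸ k) ≡ 1
    a₁-inWindow = occupied-[-]-inside a₁ (suc k) (n ∸ k) k<a₁ (subst (a₁ <_) (sym window) (s≤s a₁≤n))

  hall-1+n : a₁ ≤ k → Hall (suc n) [ a₁ ] mid
  hall-1+n a₁≤k x d x+d≡1+n = begin
    occupied [ a₁ ] x d + countIn x (suc n) mid ≤⟨ +-monoʳ-≤ (occupied [ a₁ ] x d) (count-mono _ _ proj₁ mid) ⟩
    occupied [ a₁ ] x d + count≥ x mid          ≤⟨ shuffle-room S a₁ x d a₁≤k (trans x+d≡1+n (cong suc (sym (m+[n∸m]≡n k≤n)))) ⟩
    d                                           ∎
    where open ≤-Reasoning

  record Parked : Set where
    field
      F Q      : List ℕ
      parked   : parkAll n [ a₁ ] mid ≡ just F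
      F≡Q++a₁  : F ≡ Q ++ [ a₁ ]
      |Q|≡|mid| : length Q ≡ length mid
      a₁∉Q     : a₁ ∉ Q

  park : a₁ ≤ k → Parked
  park a₁≤k with hall-parks n [ a₁ ] mid (hall-1+n a₁≤k) mid≤n
  ... | F , parked with parkAll-shape n [ a₁ ] mid parked
  ...   | Q , F≡Q++a₁ , |Q|≡|mid| , disjoint =
    record { F = F ; Q = Q ; parked = parked ; F≡Q++a₁ = F≡Q++a₁ ; |Q|≡|mid| = |Q|≡|mid|
           ; a₁∉Q = λ a₁∈Q → disjoint (here refl , a₁∈Q) }

  module _ (a₁≤k : a₁ ≤ k) where
    open Parked (park a₁≤k)

    metered⇔≤ : ∀ c → a₁ ≤ c → c ≤ n → c ∉ Q → (∀ {s} → c < s → s ≤ n → s ∈ F) → MP ⇔ aₘ ≤ c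
    metered⇔≤ c a₁≤c c≤n c∉Q aboveTaken =
      hasFreeSpot⇔ c≤n c∉Q aboveInQ ⇔-∘ metered⇔lastCarParks n a₁ aₘ mid a₁≤n parked F≡Q++a₁ |Q|≡|mid|
      where
      aboveInQ : ∀ {s} → c < s → s ≤ n → s ∈ Q
      aboveInQ {s} c<s s≤n with ∈-++⁻ Q (subst (s ∈_) F≡Q++a₁ (aboveTaken c<s s≤n))
      ... | inj₁ s∈Q        = s∈Q
      ... | inj₂ (here refl) = contradiction a₁≤c (<⇒≱ c<s)

    metered⇔≤a₁ : ∀ j → j < a₁ → n ∸ suc j ≤ count≥ (suc j) mid → MP ⇔ aₘ ≤ a₁
    metered⇔≤a₁ j j<a₁ carsAbove-j =
      metered⇔≤ a₁ ≤-refl a₁≤n a₁∉Q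
        (λ a₁<s s≤n → parkAll-fullAbove n [ a₁ ] mid j parked (<⇒≤ j<n) enough (<-trans j<a₁ a₁<s) s≤n)
      where
      open ≤-Reasoning
      j<n : j < n
      j<n = <-≤-trans j<a₁ a₁≤n
      a₁-inWindow : occupied [ a₁ ] (suc j) (n ∸ j) ≡ 1
      a₁-inWindow = occupied-[-]-inside a₁ (suc j) (n ∸ j) j<a₁
                      (subst (a₁ <_) (cong suc (sym (m+[n∸m]≡n (<⇒≤ j<n)))) (s≤s a₁≤n))
      enough : n ∸ j ≤ occupied [ a₁ ] (suc j) (n ∸ j) + count≥ (suc j) mid
      enough = begin
        n ∸ j                                                    ≡⟨ +-∸-assoc 1 j<n ⟩
        suc (n ∸ suc j)                                          ≤⟨ s≤s carsAbove-j ⟩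
        1 + count≥ (suc j) mid                                   ≡⟨ cong (_+ count≥ (suc j) mid) (sym a₁-inWindow) ⟩
        occupied [ a₁ ] (suc j) (n ∸ j) + count≥ (suc j) mid     ∎

    metered⇔≤k : a₁ < k → Hall k [ a₁ ] mid → MP ⇔ aₘ ≤ k
    metered⇔≤k a₁<k hall-k =
      metered⇔≤ k a₁≤k k≤n (λ k∈Q → k∉F (subst (k ∈_) (sym F≡Q++a₁) (∈-++⁺ˡ k∈Q)))
        (parkAll-fullAbove n [ a₁ ] mid k parked k≤n (≤-trans carsAbove-k (m≤n+m _ _)))
      where
      k∉F : k ∉ F
      k∉F = hall-avoids n k [ a₁ ] mid hall-k (shuffle-≢ S) (λ { (here refl) → <-irrefl refl a₁<k }) parked

  -- What the hypothesis on j provides, in either of its two cases.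
  record ChoiceOfJ (j : ℕ) : Set where
    field
      j≤k′        : j ≤ k′
      carsAbove-j : n ∸ suc j ≤ count≥ (suc j) mid
      hall-k      : a₁ ≤ j → Hall k [ a₁ ] mid

  metered⇔ : ∀ j → ChoiceOfJ j → MP ⇔ ((a₁ ≤ j × aₘ ≤ k) ⊎ (j < a₁ × a₁ ≤ k × aₘ ≤ a₁))
  metered⇔ j record { j≤k′ = j≤k′ ; carsAbove-j = carsAbove-j ; hall-k = hall-k } with a₁ ≤? k | j <? a₁
  ... | no a₁≰k | _ = mk⇔ (λ mp → contradiction mp (¬metered-a₁>k (≰⇒> a₁≰k)))
    λ { (inj₁ (a₁≤j , _))     → contradiction (≤-trans a₁≤j (m≤n⇒m≤1+n j≤k′)) a₁≰k
      ; (inj₂ (_ , a₁≤k , _)) → contradiction a₁≤k a₁≰k }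
  ... | yes a₁≤k | yes j<a₁ = mk⇔ (λ mp → inj₂ (j<a₁ , a₁≤k , Equivalence.to lastCar mp))
    λ { (inj₁ (a₁≤j , _))       → contradiction j<a₁ (≤⇒≯ a₁≤j)
      ; (inj₂ (_ , _ , aₘ≤a₁)) → Equivalence.from lastCar aₘ≤a₁ }
    where
    lastCar : MP ⇔ aₘ ≤ a₁
    lastCar = metered⇔≤a₁ a₁≤k j j<a₁ carsAbove-j
  ... | yes a₁≤k | no j≮a₁ = mk⇔ (λ mp → inj₁ (a₁≤j , Equivalence.to lastCar mp))
    λ { (inj₁ (_ , aₘ≤k))  → Equivalence.from lastCar aₘ≤k
      ; (inj₂ (j<a₁ , _)) → contradiction j<a₁ j≮a₁ }
    where
    a₁≤j : a₁ ≤ j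
    a₁≤j = ≮⇒≥ j≮a₁
    lastCar : MP ⇔ aₘ ≤ k
    lastCar = metered⇔≤k a₁≤k (≤-<-trans a₁≤j (s≤s j≤k′)) (hall-k a₁≤j)

  choiceOfJ-shuffle : ∀ {j′} → ShuffleOfPF (suc j′) (k′ ∸ suc j′) (filter (_<? k) mid) → suc j′ ≤ k′ →
                      ChoiceOfJ (suc j′)
  choiceOfJ-shuffle {j′} T j≤k′ = record { j≤k′ = j≤k′ ; carsAbove-j = carsAbove-j ; hall-k = hall-k }
    where
    j : ℕ
    j = suc j′
    T′ : ShuffleOfPF j (k′ ∸ j) (ShuffleOfPF.low S)
    T′ = subst (ShuffleOfPF j (k′ ∸ j)) (filter-shuffle S) T

    carsAbove-j : n ∸ suc j ≤ count≥ (suc j) mid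
    carsAbove-j = begin
      n ∸ suc j                                                ≡⟨ sym (∸-telescope (s≤s j≤k′) k≤n) ⟩
      (k′ ∸ j) + (n ∸ k)                                       ≤⟨ +-monoˡ-≤ (n ∸ k) (m≤n+m (k′ ∸ j) _) ⟩
      count≥ (suc j) (ShuffleOfPF.low T′) + (k′ ∸ j) + (n ∸ k) ≡⟨ cong (_+ (n ∸ k)) (sym (count≥-shuffle T′ (suc j) ≤-refl)) ⟩
      count≥ (suc j) (ShuffleOfPF.low S) + (n ∸ k)             ≡⟨ sym (count≥-shuffle S (suc j) (s≤s (m≤n⇒m≤1+n j≤k′))) ⟩
      count≥ (suc j) mid                                       ∎
      where open ≤-Reasoning

    hall-k : a₁ ≤ j → Hall k [ a₁ ] mid
    hall-k a₁≤j x d x+d≡k = begin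
      occupied [ a₁ ] x d + countIn x k mid                  ≤⟨ +-monoʳ-≤ (occupied [ a₁ ] x d) (countIn-shuffle S x) ⟩
      occupied [ a₁ ] x d + count≥ x (ShuffleOfPF.low S)     ≤⟨ shuffle-room T′ a₁ x d a₁≤j x+d≡2+j+[k′∸j] ⟩
      d                                                      ∎
      where
      open ≤-Reasoning
      x+d≡2+j+[k′∸j] : x + d ≡ suc (j + (k′ ∸ j))
      x+d≡2+j+[k′∸j] = trans x+d≡k (cong suc (sym (m+[n∸m]≡n j≤k′)))

  choiceOfJ-zero : 1 ≤ a₁ → All (1 ≤_) mid → length mid + 1 ≡ n → ChoiceOfJ 0
  choiceOfJ-zero 1≤a₁ positive |mid|+1≡n = record
    { j≤k′        = z≤n
    ; carsAbove-j = ≤-reflexive (begin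
        n ∸ 1               ≡⟨ cong (_∸ 1) (sym |mid|+1≡n) ⟩
        length mid + 1 ∸ 1  ≡⟨ m+n∸n≡m (length mid) 1 ⟩
        length mid          ≡⟨ sym (count-all (1 ≤?_) positive) ⟩
        count≥ 1 mid        ∎)
    ; hall-k      = λ a₁≤0 → contradiction (≤-trans 1≤a₁ a₁≤0) λ ()
    }
    where open ≡-Reasoning

theorem4p10 : (m n k : ℕ) (a₁ aₘ : ℕ) (mid : List ℕ) →
    length mid + 2 ≡ m → 2 < m → m ≤ suc n →
    All (λ x → 1 ≤ x × x ≤ n) (a₁ ∷ mid ++ [ aₘ ]) →
    1 ≤ k → k ≤ n → Sh (m ∸ 1) n k mid →
    (j : ℕ) →
    ((m ≤ n × 1 ≤ j × j ≤ k ∸ 1 × Sh ((m + k) ∸ suc n) (k ∸ 1) j (filter (_<? k) mid))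
      ⊎ (m ≡ suc n × j ≡ 0)) →
    (MeteredPF (m ∸ 2) n (a₁ ∷ mid ++ [ aₘ ])
      ⇔ ((a₁ ≤ j × aₘ ≤ k) ⊎ (j < a₁ × a₁ ≤ k × aₘ ≤ a₁)))
theorem4p10 _ n zero     _  _  _   _    _ _ _                          () _   _  _ _
theorem4p10 _ n (suc k′) a₁ aₘ mid refl _ _ ((1≤a₁ , a₁≤n) ∷ entries) _  k≤n sh j choice
  rewrite m+n∸n≡m (length mid) 2 = metered⇔ j (choiceOfJ j choice)
  where
  mid-entries : All (λ x → 1 ≤ x × x ≤ n) mid
  mid-entries = ++⁻ˡ mid entries
  open Setting n k′ a₁ aₘ mid (sh⇒shuffleOfPF {N = n} sh) k≤n a₁≤n (All.map proj₂ mid-entries)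
  choiceOfJ : ∀ j {M} → (length mid + 2 ≤ n × 1 ≤ j × j ≤ k′ × Sh M k′ j (filter (_<? suc k′) mid))
                        ⊎ (length mid + 2 ≡ suc n × j ≡ 0) → ChoiceOfJ j
  choiceOfJ (suc j′) (inj₁ (_ , _ , j≤k′ , shj)) = choiceOfJ-shuffle (sh⇒shuffleOfPF {N = k′} shj) j≤k′
  choiceOfJ j (inj₂ (|mid|+2≡1+n , refl)) =
    choiceOfJ-zero 1≤a₁ (All.map proj₁ mid-entries)
      (suc-injective (trans (sym (+-suc (length mid) 1)) |mid|+2≡1+n))
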